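{- Let $M=U_{2,2}$ be the matroid on $E=\{1<2\}$ with rank function $\mathrm{rk}(S)=|S|$, and let $a,b$ be nonzero integers. Define the $\mathbb{Z}$-quasi-representation $\rho_{(a,b)}$ by $N=\rho_{(a,b)}(E)=\mathbb{Z}^2$, $\rho_{(a,b)}(\emptyset)=0$, $\rho_{(a,b)}(\{1\})=\langle(a,0)\rangle$, $\rho_{(a,b)}(\{2\})=\langle(0,b)\rangle$. Then \[H^{1,1}(M,\rho_{(a,b)})\cong\mathbb{Z}/a\mathbb{Z}\oplus\mathbb{Z}/b\mathbb{Z},\quad H^{0,2}(M,\rho_{(a,b)})\cong\mathbb{Z},\quad H^{1,2}(M,\rho_{(a,b)})\cong\mathbb{Z}/\gcd(a,b)\mathbb{Z},\] and all other $H^{i,j}(M,\rho_{(a,b)})$ vanish.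
   Context: $H^{i,j}(M,\rho)$ is the cohomology of the complex $C^{i,j}=\bigoplus_{S\subseteq E,|S|=i}\bigwedge^j_\mathbb{Z}(N/\rho(S))$ with differential $\sum_{|S|=i}\sum_{f\notin S}\epsilon^{S,f}d^{S,f}:C^{i,j}\to C^{i+1,j}$, where $d^{S,f}$ is induced by the projection $N/\rho(S)\to N/\rho(S\cup f)$ and $\epsilon^{S,f}=(-1)^{|\{f'\in S:f'<f\}|}$. -}

module Defs where

open import Data.Bool using (Bool; true; false; if_then_else_; not; _∧_)
open import Data.Nat as ℕ using (ℕ; zero; suc)
open import Data.Integer using (ℤ; +_; _+_; _-_; _*_; -_; 0ℤ; 1ℤ)
open import Data.Integer.Divisibility using (_∣_)
open import Data.Integer.GCD using (gcd)
open import Data.Fin using (Fin; zero; suc; toℕ)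
open import Data.Fin.Subset using (Subset; ⁅_⁆; _∪_; ∣_∣; inside; outside) renaming (_-_ to _∖_)
open import Data.Vec using (Vec; []; _∷_) renaming (lookup to vlookup)
open import Data.Vec.Properties using (≡-dec)
import Data.Bool.Properties as BoolP
open import Data.List using (List; []; _∷_; _++_; map; length; lookup)
open import Data.Product using (Σ; _×_; _,_)
open import Relation.Binary.PropositionalEquality using (_≡_)
open import Relation.Nullary.Decidable using (⌊_⌋)

∑ : ∀ {k} → (Fin k → ℤ) → ℤ
∑ {zero}  f = 0ℤ
∑ {suc k} f = f zero + ∑ (λ i → f (suc i))

allSubsets : ∀ n → List (Subset n)
allSubsets zero    = [] ∷ []
allSubsets (suc n) = map (inside ∷_) (allSubsets n) ++ map (outside ∷_) (allSubsets n)

∑ₗ : ∀ {A : Set} → List A → (A → ℤ) → ℤ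
∑ₗ []       f = 0ℤ
∑ₗ (x ∷ xs) f = f x + ∑ₗ xs f

∑ₛ : ∀ {n} → (Subset n → ℤ) → ℤ
∑ₛ {n} f = ∑ₗ (allSubsets n) f

below : ∀ {n} → Subset n → Fin n → ℕ
below {zero}  []      ()
below {suc n} (b ∷ T) zero    = 0
below {suc n} (b ∷ T) (suc k) = (if b then 1 else 0) ℕ.+ below T k

sgn : ℕ → ℤ
sgn zero    = 1ℤ
sgn (suc p) = - sgn p

_≟ₛ_ : ∀ {n} (S T : Subset n) → Bool
S ≟ₛ T = ⌊ ≡-dec BoolP._≟_ S T ⌋

-- Free module ℤ^n and its exterior algebra ⋀ ℤ^n
-- An element of ⋀ ℤ^n is given by its coordinates in the basis
-- e_T = e_{t₁} ∧ … ∧ e_{t_r} (t₁ < … < t_r), T ⊆ Fin n; the degree-j part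
-- ⋀^j ℤ^n consists of the coordinates at |T| = j.

Vecℤ : ℕ → Set
Vecℤ n = Fin n → ℤ

Λ : ℕ → Set
Λ n = Subset n → ℤ

-- coordinate at e_U of  l ∧ e_T ,  using  e_k ∧ e_T = (-1)^{#{t∈T : t<k}} e_{T∪k}
-- for k ∉ T (and 0 for k ∈ T).
wedgeCoeff : ∀ {n} → Vecℤ n → Subset n → Subset n → ℤ
wedgeCoeff l T U =
  ∑ (λ k → if not (vlookup T k) ∧ (U ≟ₛ (T ∪ ⁅ k ⁆)) then sgn (below T k) * l k else 0ℤ)

-- x lies in the degree-j part of the ideal of ⋀ ℤ^n generated by the span L of gens,
-- i.e. in the kernel of ⋀^j ℤ^n → ⋀^j (ℤ^n / L): x is a ℤ-combination of the
-- elements l ∧ e_T (l ∈ gens).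
InIdeal : ∀ {n} → List (Vecℤ n) → ℕ → Λ n → Set
InIdeal {n} gens j x =
  Σ (Fin (length gens) → Subset n → ℤ) λ c →
    ∀ U → ∣ U ∣ ≡ j →
      x U ≡ ∑ (λ g → ∑ₛ (λ T → c g T * wedgeCoeff (lookup gens g) T U))

-- The complex C^{i,j} = ⊕_{|S|=i} ⋀^j (N / ρ(S)),  N = ℤ^n, E = Fin m.
-- ρ(S) is given by a finite list of generators of the submodule ρ(S) ⊆ N.
-- A cochain assigns to each S ⊆ E an element of ⋀ ℤ^n (a representative);
-- only the components with |S| = i and degree j are relevant in C^{i,j}.

Cochain : ℕ → ℕ → Set
Cochain m n = Subset m → Λ n

0C : ∀ {m n} → Cochain m n
0C S U = 0ℤ

_+C_ : ∀ {m n} → Cochain m n → Cochain m n → Cochain m n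
(x +C y) S U = x S U + y S U

ε : ∀ {m} → Subset m → Fin m → ℤ
ε S f = sgn (below S f)

-- differential: (d x)_{S'} = Σ_{f ∈ S'} ε^{S'∖f , f} d^{S'∖f , f}(x_{S'∖f});
-- d^{S,f} is induced by the identity of ⋀^j N on representatives.
d : ∀ {m n} → Cochain m n → Cochain m n
d x S' U = ∑ (λ f → if vlookup S' f then ε (S' ∖ f) f * x (S' ∖ f) U else 0ℤ)

module _ {m n : ℕ} (ρ : Subset m → List (Vecℤ n)) where

  EqC : ℕ → ℕ → Cochain m n → Cochain m n → Set
  EqC i j x y = ∀ S → ∣ S ∣ ≡ i → InIdeal (ρ S) j (λ U → x S U - y S U)

  IsCocycle : ℕ → ℕ → Cochain m n → Set
  IsCocycle i j x = EqC (suc i) j (d x) 0C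

  Cohomologous : ℕ → ℕ → Cochain m n → Cochain m n → Set
  Cohomologous i j x y = Σ (Cochain m n) λ z → EqC i j (x +C (λ S U → - y S U)) (d z)

  Vanishes : ℕ → ℕ → Set
  Vanishes i j = ∀ x → IsCocycle i j x → Cohomologous i j x 0C

  -- An isomorphism of abelian groups H^{i,j}(M,ρ) ≅ B, where B is an abelian
  -- group given by a carrier, an equality and an addition: mutually inverse
  -- additive maps (respecting the equalities) between cocycles mod coboundaries and B.
  record HIso (i j : ℕ) {B : Set} (_≈B_ : B → B → Set) (_+B_ : B → B → B) : Set where
    field
      to           : Cochain m n → B
      from         : B → Cochain m n
      to-cong      : ∀ x y → IsCocycle i j x → IsCocycle i j y →
                     Cohomologous i j x y → to x ≈B to y
      to-hom       : ∀ x y → IsCocycle i j x → IsCocycle i j y →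
                     to (x +C y) ≈B (to x +B to y)
      from-cocycle : ∀ b → IsCocycle i j (from b)
      from-cong    : ∀ b b′ → b ≈B b′ → Cohomologous i j (from b) (from b′)
      from-to      : ∀ x → IsCocycle i j x → Cohomologous i j (from (to x)) x
      to-from      : ∀ b → to (from b) ≈B b

_≈⊕[_,_]_ : ℤ × ℤ → ℤ → ℤ → ℤ × ℤ → Set
(x₁ , x₂) ≈⊕[ a , b ] (y₁ , y₂) = (a ∣ (x₁ - y₁)) × (b ∣ (x₂ - y₂))

_+⊕_ : ℤ × ℤ → ℤ × ℤ → ℤ × ℤ
(x₁ , x₂) +⊕ (y₁ , y₂) = (x₁ + y₁ , x₂ + y₂)

_≡_[mod_] : ℤ → ℤ → ℤ → Set
x ≡ y [mod c ] = c ∣ (x - y)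

-- The quasi-representation ρ_{(a,b)} of U_{2,2} on E = {1 < 2} = Fin 2
-- (element 1 = zero, element 2 = suc zero), N = ℤ².

v2 : ℤ → ℤ → Vecℤ 2
v2 x y zero       = x
v2 x y (suc zero) = y

ρab : ℤ → ℤ → Subset 2 → List (Vecℤ 2)
ρab a b (outside ∷ outside ∷ []) = []
ρab a b (inside  ∷ outside ∷ []) = v2 a 0ℤ ∷ []
ρab a b (outside ∷ inside  ∷ []) = v2 0ℤ b ∷ []
ρab a b (inside  ∷ inside  ∷ []) = v2 1ℤ 0ℤ ∷ v2 0ℤ 1ℤ ∷ []

module Submission where

-- Over E = {1, 2} the complex is C^{0,j} = ⋀^j N, C^{1,j} = ⋀^j (N/ρ{1}) ⊕ ⋀^j (N/ρ{2}),
-- C^{2,j} = ⋀^j (N/N), with d x = (x, x) and d (x₁, x₂) = x₂ - x₁.  Let I₁, I₂ be the ideals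
-- of ⋀ ℤ² generated by (a,0) and (0,b).  Then H^{0,j} = (I₁ ∩ I₂)_j, and for j ≥ 1, where
-- C^{2,j} = 0, H^{1,j} ≅ (⋀ ℤ² / (I₁ + I₂))_j via (x₁, x₂) ↦ x₂ - x₁.  In degree 1 the ideals
-- are aℤ e₁ and bℤ e₂, giving H^{0,1} = 0 and H^{1,1} ≅ ℤ/a ⊕ ℤ/b; in degree 2 they are
-- aℤ e₁∧e₂ and bℤ e₁∧e₂, giving H^{0,2} = lcm(a,b) ℤ ≅ ℤ (as a, b ≠ 0) and
-- H^{1,2} ≅ ℤ/(aℤ + bℤ) = ℤ/gcd(a,b) by Bézout.  In degree 0 the ideals vanish and
-- ℤ → ℤ² → ℤ is exact; finally ⋀^{≥3} ℤ² = 0.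

open import Defs
open import Data.Fin using (Fin; zero; suc)
open import Data.Fin.Subset using (Subset; inside; outside; ∣_∣)
open import Data.Integer using (ℤ; +_; _+_; _-_; _*_; -_; _/_; _%_; 0ℤ; 1ℤ; -1ℤ; NonZero; ≢-nonZero)
import Data.Integer as ℤ
open import Data.Integer.Properties
  using (+-identityˡ; +-identityʳ; *-identityˡ; *-zeroʳ; +-inverseʳ; neg-distribˡ-*;
         *-cancelʳ-≡; *-distribʳ-+; *-comm; i≡j⇒i-j≡0; i-j≡0⇒i≡j; i*j≡0⇒i≡0∨j≡0; pos-+; pos-*)
open import Data.Integer.DivMod using (a≡a%n+[a/n]*n; n%d<d)
open import Data.Integer.Divisibility.Signed
  using (_∣_; divides; ∣ᵤ⇒∣; ∣⇒∣ᵤ; ∣-trans; ∣m+n∣n⇒∣m; ∣m∣n⇒∣m-n; ∣m⇒∣-m; 0∣⇒≡0; m∣∣m∣)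
open import Data.Integer.GCD using (gcd; gcd[i,j]∣i; gcd[i,j]∣j)
open import Data.Integer.LCM using (lcm; i∣lcm[i,j]; j∣lcm[i,j]; lcm-least)
open import Data.Integer.Tactic.RingSolver using (solve-∀)
open import Data.List using (List; []; _∷_; length; lookup)
open import Data.Nat as ℕ using (ℕ; zero; suc)
import Data.Nat.Divisibility as ℕ
import Data.Nat.GCD as ℕ
open import Data.Product using (Σ; ∃₂; _×_; _,_; proj₁; proj₂)
open import Data.Sum using ([_,_]′)
open import Data.Vec using ([]; _∷_)
open import Function.Bundles using (_⇔_; mk⇔; Equivalence)
open import Relation.Binary.PropositionalEquality
  using (_≡_; _≢_; refl; sym; trans; cong; cong₂; subst; module ≡-Reasoning)
open import Relation.Nullary using (¬_; contradiction)

open ≡-Reasoning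

≡⇒≡[mod] : ∀ {x y} k → x ≡ y → x ≡ y [mod k ]
≡⇒≡[mod] {x} {y} k x≡y = ∣⇒∣ᵤ {k} {x - y} (divides 0ℤ (i≡j⇒i-j≡0 x≡y))

≡[mod]-by-difference : ∀ {k} x y {s t} → x - y ≡ t - s → k ∣ t → k ∣ s → x ≡ y [mod k ]
≡[mod]-by-difference {k} x y x-y≡t-s k∣t k∣s =
  ∣⇒∣ᵤ {k} {x - y} (subst (k ∣_) (sym x-y≡t-s) (∣m∣n⇒∣m-n k∣t k∣s))

<∧∣⇒≡0 : ∀ {m n} → m ℕ.< n → n ℕ.∣ m → m ≡ 0
<∧∣⇒≡0 {zero}  _   _   = refl
<∧∣⇒≡0 {suc m} m<n n∣m = contradiction n∣m (ℕ.>⇒∤ m<n)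

i*j/j≡i : ∀ i j .{{_ : NonZero j}} → i * j / j ≡ i
i*j/j≡i i j = sym (*-cancelʳ-≡ i q j (begin
  i * j          ≡⟨ a≡a%n+[a/n]*n (i * j) j ⟩
  + r + q * j    ≡⟨ cong (λ m → + m + q * j) r≡0 ⟩
  0ℤ + q * j     ≡⟨ +-identityˡ (q * j) ⟩
  q * j          ∎))
  where
  q : ℤ
  q = i * j / j
  r : ℕ
  r = i * j % j
  -- r = (i - q) * j is a multiple of j smaller than ∣ j ∣
  j∣r : j ∣ + r
  j∣r = ∣m+n∣n⇒∣m (subst (j ∣_) (a≡a%n+[a/n]*n (i * j) j) (divides i refl)) (divides q refl)
  r≡0 : r ≡ 0
  r≡0 = <∧∣⇒≡0 (n%d<d (i * j) j) (∣⇒∣ᵤ j∣r)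

i/j*j≡i : ∀ {i} j .{{_ : NonZero j}} → j ∣ i → i / j * j ≡ i
i/j*j≡i j (divides q refl) = cong (_* j) (i*j/j≡i q j)

+-distrib-/-∣ : ∀ {i k} j .{{_ : NonZero j}} → j ∣ i → j ∣ k → (i + k) / j ≡ i / j + k / j
+-distrib-/-∣ j (divides p refl) (divides q refl) = begin
  (p * j + q * j) / j    ≡⟨ cong (λ t → t / j) (sym (*-distribʳ-+ j p q)) ⟩
  (p + q) * j / j        ≡⟨ i*j/j≡i (p + q) j ⟩
  p + q                  ≡⟨ sym (cong₂ _+_ (i*j/j≡i p j) (i*j/j≡i q j)) ⟩
  p * j / j + q * j / j  ∎

lcm≢0 : ∀ {a b} → a ≢ 0ℤ → b ≢ 0ℤ → lcm a b ≢ 0ℤ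
lcm≢0 {a} {b} a≢0 b≢0 lcm≡0 =
  [ a≢0 , b≢0 ]′ (i*j≡0⇒i≡0∨j≡0 a (0∣⇒≡0 (subst (_∣ a * b) lcm≡0 lcm∣ab)))
  where
  lcm∣ab : lcm a b ∣ a * b
  lcm∣ab = ∣ᵤ⇒∣ (lcm-least {a} {b} {a * b} (∣⇒∣ᵤ {a} (divides b (*-comm a b)))
                                            (∣⇒∣ᵤ {b} (divides a refl)))

+g≡x*m-y*n : ∀ {g m n} (x y : ℕ) → g ℕ.+ y ℕ.* n ≡ x ℕ.* m → + g ≡ + x * + m - + y * + n
+g≡x*m-y*n {g} {m} {n} x y eq = begin
  + g                              ≡⟨ cancel (+ g) (+ (y ℕ.* n)) ⟩
  + g + + (y ℕ.* n) - + (y ℕ.* n)  ≡⟨ cong (λ t → t - + (y ℕ.* n)) (sym (pos-+ g (y ℕ.* n))) ⟩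
  + (g ℕ.+ y ℕ.* n) - + (y ℕ.* n)  ≡⟨ cong (λ t → + t - + (y ℕ.* n)) eq ⟩
  + (x ℕ.* m) - + (y ℕ.* n)        ≡⟨ cong₂ _-_ (pos-* x m) (pos-* y n) ⟩
  + x * + m - + y * + n            ∎
  where
  cancel : ∀ p q → p ≡ p + q - q
  cancel = solve-∀

bézout : ∀ a b → ∃₂ λ u v → gcd a b ≡ u * a + v * b
bézout a b with m∣∣m∣ {a} | m∣∣m∣ {b} | ℕ.Bézout.identity (ℕ.gcd-GCD ℤ.∣ a ∣ ℤ.∣ b ∣)
... | divides σa ∣a∣≡ | divides σb ∣b∣≡ | ℕ.Bézout.+- x y eq =
  + x * σa , - (+ y * σb) , (begin
    gcd a b                          ≡⟨ +g≡x*m-y*n x y eq ⟩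
    + x * + ℤ.∣ a ∣ - + y * + ℤ.∣ b ∣  ≡⟨ cong₂ (λ A B → + x * A - + y * B) ∣a∣≡ ∣b∣≡ ⟩
    + x * (σa * a) - + y * (σb * b)  ≡⟨ regroup (+ x) (+ y) σa σb a b ⟩
    + x * σa * a + - (+ y * σb) * b  ∎)
  where
  regroup : ∀ x y σa σb a b → x * (σa * a) - y * (σb * b) ≡ x * σa * a + - (y * σb) * b
  regroup = solve-∀
... | divides σa ∣a∣≡ | divides σb ∣b∣≡ | ℕ.Bézout.-+ x y eq =
  - (+ x * σa) , + y * σb , (begin
    gcd a b                          ≡⟨ +g≡x*m-y*n y x eq ⟩
    + y * + ℤ.∣ b ∣ - + x * + ℤ.∣ a ∣  ≡⟨ cong₂ (λ B A → + y * B - + x * A) ∣b∣≡ ∣a∣≡ ⟩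
    + y * (σb * b) - + x * (σa * a)  ≡⟨ regroup (+ x) (+ y) σa σb a b ⟩
    - (+ x * σa) * a + + y * σb * b  ∎)
  where
  regroup : ∀ x y σa σb a b → y * (σb * b) - x * (σa * a) ≡ - (x * σa) * a + y * σb * b
  regroup = solve-∀

gcd∣⇒lincomb : ∀ a b {c} → gcd a b ∣ c → ∃₂ λ u v → c ≡ u * a + v * b
gcd∣⇒lincomb a b (divides k refl) =
  let u , v , gcd≡ = bézout a b in
  k * u , k * v , trans (cong (k *_) gcd≡) (distrib k u v a b)
  where
  distrib : ∀ k u v a b → k * (u * a + v * b) ≡ k * u * a + k * v * b
  distrib = solve-∀

-- Subsets of Fin 2 index both the S ⊆ E = {1 < 2} (with 1 = zero) and the basis e_U of ⋀ ℤ².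
pattern ∅   = outside ∷ outside ∷ []
pattern ⁅1⁆ = inside  ∷ outside ∷ []
pattern ⁅2⁆ = outside ∷ inside  ∷ []
pattern E   = inside  ∷ inside  ∷ []

[_,_,_,_] : {A : Set} → A → A → A → A → Subset 2 → A
[ x∅ , x₁ , x₂ , xE ] ∅   = x∅
[ x∅ , x₁ , x₂ , xE ] ⁅1⁆ = x₁
[ x∅ , x₁ , x₂ , xE ] ⁅2⁆ = x₂
[ x∅ , x₁ , x₂ , xE ] E   = xE

module _ {P : Subset 2 → Set} where

  size≡0-elim : P ∅ → ∀ S → ∣ S ∣ ≡ 0 → P S
  size≡0-elim p ∅   _  = p
  size≡0-elim p ⁅1⁆ ()
  size≡0-elim p ⁅2⁆ ()
  size≡0-elim p E   ()

  size≡1-elim : P ⁅1⁆ → P ⁅2⁆ → ∀ S → ∣ S ∣ ≡ 1 → P S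
  size≡1-elim p₁ p₂ ∅   ()
  size≡1-elim p₁ p₂ ⁅1⁆ _  = p₁
  size≡1-elim p₁ p₂ ⁅2⁆ _  = p₂
  size≡1-elim p₁ p₂ E   ()

  size≡2-elim : P E → ∀ S → ∣ S ∣ ≡ 2 → P S
  size≡2-elim p ∅   ()
  size≡2-elim p ⁅1⁆ ()
  size≡2-elim p ⁅2⁆ ()
  size≡2-elim p E   _  = p

  size≥3-elim : ∀ {k} S → ∣ S ∣ ≡ 3 ℕ.+ k → P S
  size≥3-elim ∅ ()
  size≥3-elim ⁅1⁆ ()
  size≥3-elim ⁅2⁆ ()
  size≥3-elim E ()

_≗[_]_ : ∀ {n} → Λ n → ℕ → Λ n → Set
v ≗[ j ] w = ∀ U → ∣ U ∣ ≡ j → v U ≡ w U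

0Λ : ∀ {n} → Λ n
0Λ U = 0ℤ

∑-zero : ∀ {k} {f : Fin k → ℤ} → (∀ i → f i ≡ 0ℤ) → ∑ f ≡ 0ℤ
∑-zero {zero}  f≡0 = refl
∑-zero {suc k} f≡0 = cong₂ _+_ (f≡0 zero) (∑-zero (λ i → f≡0 (suc i)))

∑ₗ-zero : ∀ {A : Set} (xs : List A) → ∑ₗ xs (λ _ → 0ℤ) ≡ 0ℤ
∑ₗ-zero []       = refl
∑ₗ-zero (_ ∷ xs) = cong (_+_ 0ℤ) (∑ₗ-zero xs)

module _ {n} (gens : List (Vecℤ n)) {j : ℕ} where

  inIdeal-resp-≗ : ∀ {v w} → v ≗[ j ] w → InIdeal gens j v → InIdeal gens j w
  inIdeal-resp-≗ v≗w (c , v≡) = c , λ U ∣U∣≡j → trans (sym (v≗w U ∣U∣≡j)) (v≡ U ∣U∣≡j)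

  inIdeal-0 : ∀ {v} → v ≗[ j ] 0Λ → InIdeal gens j v
  inIdeal-0 v≗0 = (λ _ _ → 0ℤ) , λ U ∣U∣≡j →
    trans (v≗0 U ∣U∣≡j) (sym (∑-zero {length gens} (λ _ → ∑ₗ-zero (allSubsets n))))

inIdeal[]⇒≗0 : ∀ {n j} {v : Λ n} → InIdeal [] j v → v ≗[ j ] 0Λ
inIdeal[]⇒≗0 = proj₂

module _ {n} (x : Cochain 2 n) (U : Subset n) where

  d-⁅1⁆ : d x ⁅1⁆ U ≡ x ∅ U
  d-⁅1⁆ = trans (+-identityʳ _) (*-identityˡ _)

  d-⁅2⁆ : d x ⁅2⁆ U ≡ x ∅ U
  d-⁅2⁆ = trans (+-identityˡ _) d-⁅1⁆

δ : ∀ {n} → Cochain 2 n → Λ n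
δ x U = x ⁅2⁆ U - x ⁅1⁆ U

d-E : ∀ {n} (x : Cochain 2 n) U → d x E U ≡ δ x U
d-E x U = expand (x ⁅2⁆ U) (x ⁅1⁆ U)
  where
  expand : ∀ p q → 1ℤ * p + (-1ℤ * q + 0ℤ) ≡ p - q
  expand = solve-∀

δ-+ : ∀ {n} (x y : Cochain 2 n) U → δ (x +C y) U ≡ δ x U + δ y U
δ-+ x y U = regroup (x ⁅2⁆ U) (y ⁅2⁆ U) (x ⁅1⁆ U) (y ⁅1⁆ U)
  where
  regroup : ∀ p q r s → (p + q) - (r + s) ≡ (p - r) + (q - s)
  regroup = solve-∀

module _ {n} (ρ : Subset 2 → List (Vecℤ n)) {j : ℕ} where

  cocycle⁰⇔ : ∀ x → IsCocycle ρ 0 j x ⇔ (InIdeal (ρ ⁅1⁆) j (x ∅) × InIdeal (ρ ⁅2⁆) j (x ∅))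
  cocycle⁰⇔ x = mk⇔
    (λ dx≈0 → inIdeal-resp-≗ (ρ ⁅1⁆) dx₁≗ (dx≈0 ⁅1⁆ refl) ,
              inIdeal-resp-≗ (ρ ⁅2⁆) dx₂≗ (dx≈0 ⁅2⁆ refl))
    (λ (h₁ , h₂) → size≡1-elim (inIdeal-resp-≗ (ρ ⁅1⁆) (λ U e → sym (dx₁≗ U e)) h₁)
                                (inIdeal-resp-≗ (ρ ⁅2⁆) (λ U e → sym (dx₂≗ U e)) h₂))
    where
    dx₁≗ : (λ U → d x ⁅1⁆ U - 0ℤ) ≗[ j ] x ∅
    dx₁≗ U _ = trans (+-identityʳ _) (d-⁅1⁆ x U)
    dx₂≗ : (λ U → d x ⁅2⁆ U - 0ℤ) ≗[ j ] x ∅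
    dx₂≗ U _ = trans (+-identityʳ _) (d-⁅2⁆ x U)

  cocycle¹⇔ : ∀ x → IsCocycle ρ 1 j x ⇔ InIdeal (ρ E) j (δ x)
  cocycle¹⇔ x = mk⇔
    (λ dx≈0 → inIdeal-resp-≗ (ρ E) dxE≗ (dx≈0 E refl))
    (λ h → size≡2-elim (inIdeal-resp-≗ (ρ E) (λ U e → sym (dxE≗ U e)) h))
    where
    dxE≗ : (λ U → d x E U - 0ℤ) ≗[ j ] δ x
    dxE≗ U _ = trans (+-identityʳ _) (d-E x U)

  cohomologous⁰⇔ : ∀ x y → Cohomologous ρ 0 j x y ⇔ InIdeal (ρ ∅) j (λ U → x ∅ U - y ∅ U)
  cohomologous⁰⇔ x y = mk⇔
    (λ (_ , h) → inIdeal-resp-≗ (ρ ∅) (λ U _ → +-identityʳ _) (h ∅ refl))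
    (λ h → 0C , size≡0-elim (inIdeal-resp-≗ (ρ ∅) (λ U _ → sym (+-identityʳ _)) h))

  -- v - w ∈ I₁ + I₂ in degree j, for I_k the ideal generated by ρ{k}; written as t - s so that
  -- closure of InIdeal under negation is never needed.
  CongruentModSum : Λ n → Λ n → Set
  CongruentModSum v w = ∃₂ λ s t → InIdeal (ρ ⁅1⁆) j s × InIdeal (ρ ⁅2⁆) j t ×
                                   (λ U → v U - w U) ≗[ j ] (λ U → t U - s U)

  cohomologous¹⇔ : ∀ x y → Cohomologous ρ 1 j x y ⇔ CongruentModSum (δ x) (δ y)
  cohomologous¹⇔ x y = mk⇔ to from
    where
    Δ₁ Δ₂ : Λ n
    Δ₁ U = x ⁅1⁆ U - y ⁅1⁆ U
    Δ₂ U = x ⁅2⁆ U - y ⁅2⁆ U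

    to : Cohomologous ρ 1 j x y → CongruentModSum (δ x) (δ y)
    to (z , h) = (λ U → Δ₁ U - z ∅ U) , (λ U → Δ₂ U - z ∅ U)
               , inIdeal-resp-≗ (ρ ⁅1⁆) (λ U _ → cong (_-_ (Δ₁ U)) (d-⁅1⁆ z U)) (h ⁅1⁆ refl)
               , inIdeal-resp-≗ (ρ ⁅2⁆) (λ U _ → cong (_-_ (Δ₂ U)) (d-⁅2⁆ z U)) (h ⁅2⁆ refl)
               , λ U _ → shift (x ⁅2⁆ U) (x ⁅1⁆ U) (y ⁅2⁆ U) (y ⁅1⁆ U) (z ∅ U)
      where
      shift : ∀ p q r s w → (p - q) - (r - s) ≡ (p - r - w) - (q - s - w)
      shift = solve-∀

    from : CongruentModSum (δ x) (δ y) → Cohomologous ρ 1 j x y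
    from (s , t , hs , ht , δ≗) =
      z , size≡1-elim (inIdeal-resp-≗ (ρ ⁅1⁆) slot₁ hs) (inIdeal-resp-≗ (ρ ⁅2⁆) slot₂ ht)
      where
      z : Cochain 2 n
      z _ U = Δ₁ U - s U
      slot₁ : s ≗[ j ] (λ U → Δ₁ U - d z ⁅1⁆ U)
      slot₁ U _ = trans (cancel (Δ₁ U) (s U)) (cong (_-_ (Δ₁ U)) (sym (d-⁅1⁆ z U)))
        where
        cancel : ∀ p s → s ≡ p - (p - s)
        cancel = solve-∀
      slot₂ : t ≗[ j ] (λ U → Δ₂ U - d z ⁅2⁆ U)
      slot₂ U e = begin
        t U                    ≡⟨ cancel (t U) (s U) ⟩
        t U - s U + s U        ≡⟨ cong (_+ s U) (sym (δ≗ U e)) ⟩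
        δ x U - δ y U + s U    ≡⟨ regroup (x ⁅2⁆ U) (x ⁅1⁆ U) (y ⁅2⁆ U) (y ⁅1⁆ U) (s U) ⟩
        Δ₂ U - (Δ₁ U - s U)    ≡⟨ cong (_-_ (Δ₂ U)) (sym (d-⁅2⁆ z U)) ⟩
        Δ₂ U - d z ⁅2⁆ U       ∎
        where
        cancel : ∀ t s → t ≡ t - s + s
        cancel = solve-∀
        regroup : ∀ p q r u s → (p - q) - (r - u) + s ≡ p - r - (q - u - s)
        regroup = solve-∀

  δ-section : ∀ x {v} → v ≗[ j ] δ x → Cohomologous ρ 1 j [ 0Λ , 0Λ , v , 0Λ ] x
  δ-section x {v} v≗δx = Equivalence.from (cohomologous¹⇔ [ 0Λ , 0Λ , v , 0Λ ] x)
    (0Λ , 0Λ , inIdeal-0 (ρ ⁅1⁆) (λ _ _ → refl) , inIdeal-0 (ρ ⁅2⁆) (λ _ _ → refl) ,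
     λ U e → trans (cong (_- δ x U) (trans (+-identityʳ (v U)) (v≗δx U e))) (+-inverseʳ (δ x U)))

  cohomologous²⇐ : ∀ x y (z : Cochain 2 n) →
    InIdeal (ρ E) j (λ U → x E U - y E U - δ z U) → Cohomologous ρ 2 j x y
  cohomologous²⇐ x y z h =
    z , size≡2-elim (inIdeal-resp-≗ (ρ E) (λ U _ → cong (_-_ (x E U - y E U)) (sym (d-E z U))) h)

  zero-cochains⇒vanishes : ∀ {i} → (∀ S → ∣ S ∣ ≡ i → ∀ v → InIdeal (ρ S) j v) → Vanishes ρ i j
  zero-cochains⇒vanishes C≡0 x _ = 0C , λ S ∣S∣≡i → C≡0 S ∣S∣≡i _

wedgeSum : Vecℤ 2 → (Subset 2 → ℤ) → Λ 2
wedgeSum l c U = ∑ₛ (λ T → c T * wedgeCoeff l T U)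

-- The left-hand sides below are the normal forms of the sums over T, in the order E, {1}, {2}, ∅.
module _ (l : Vecℤ 2) (c : Subset 2 → ℤ) where

  wedgeSum-∅ : wedgeSum l c ∅ ≡ 0ℤ
  wedgeSum-∅ = expand (c E) (c ⁅1⁆) (c ⁅2⁆) (c ∅)
    where
    expand : ∀ cE c₁ c₂ c∅ → cE * 0ℤ + (c₁ * 0ℤ + (c₂ * 0ℤ + (c∅ * 0ℤ + 0ℤ))) ≡ 0ℤ
    expand = solve-∀

  wedgeSum-⁅1⁆ : wedgeSum l c ⁅1⁆ ≡ c ∅ * l zero
  wedgeSum-⁅1⁆ = expand (c E) (c ⁅1⁆) (c ⁅2⁆) (c ∅) (l zero)
    where
    expand : ∀ cE c₁ c₂ c∅ l₁ →
             cE * 0ℤ + (c₁ * 0ℤ + (c₂ * 0ℤ + (c∅ * (1ℤ * l₁ + 0ℤ) + 0ℤ))) ≡ c∅ * l₁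
    expand = solve-∀

  wedgeSum-⁅2⁆ : wedgeSum l c ⁅2⁆ ≡ c ∅ * l (suc zero)
  wedgeSum-⁅2⁆ = expand (c E) (c ⁅1⁆) (c ⁅2⁆) (c ∅) (l (suc zero))
    where
    expand : ∀ cE c₁ c₂ c∅ l₂ →
             cE * 0ℤ + (c₁ * 0ℤ + (c₂ * 0ℤ + (c∅ * (0ℤ + (1ℤ * l₂ + 0ℤ)) + 0ℤ))) ≡ c∅ * l₂
    expand = solve-∀

  wedgeSum-E : wedgeSum l c E ≡ c ⁅2⁆ * l zero - c ⁅1⁆ * l (suc zero)
  wedgeSum-E = expand (c E) (c ⁅1⁆) (c ⁅2⁆) (c ∅) (l zero) (l (suc zero))
    where
    expand : ∀ cE c₁ c₂ c∅ l₁ l₂ →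
             cE * 0ℤ + (c₁ * (0ℤ + (-1ℤ * l₂ + 0ℤ)) + (c₂ * (1ℤ * l₁ + 0ℤ) + (c∅ * 0ℤ + 0ℤ)))
             ≡ c₂ * l₁ - c₁ * l₂
    expand = solve-∀

e₁ e₂ : Vecℤ 2
e₁ = v2 1ℤ 0ℤ
e₂ = v2 0ℤ 1ℤ

inIdeal-deg0⇔ : ∀ gens {v : Λ 2} → InIdeal gens 0 v ⇔ v ∅ ≡ 0ℤ
inIdeal-deg0⇔ gens = mk⇔
  (λ (c , h) → trans (h ∅ refl) (∑-zero (λ g → wedgeSum-∅ (lookup gens g) (c g))))
  (λ v∅≡0 → inIdeal-0 gens (size≡0-elim v∅≡0))

inIdeal-deg≥3 : ∀ gens {j} {v : Λ 2} → InIdeal gens (3 ℕ.+ j) v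
inIdeal-deg≥3 gens = (λ _ _ → 0ℤ) , size≥3-elim

inIdeal-single⇔ : ∀ l {j} {v : Λ 2} →
                  InIdeal (l ∷ []) j v ⇔ (Σ (Subset 2 → ℤ) λ c → v ≗[ j ] wedgeSum l c)
inIdeal-single⇔ l = mk⇔
  (λ (c , h) → c zero , λ U e → trans (h U e) (+-identityʳ _))
  (λ (c , h) → (λ _ → c) , λ U e → trans (h U e) (sym (+-identityʳ _)))

inIdeal-ℤ² : ∀ {j} {v : Λ 2} → InIdeal (e₁ ∷ e₂ ∷ []) (suc j) v
inIdeal-ℤ² {j} {v} = c , sum
  where
  c : Fin 2 → Subset 2 → ℤ
  c zero       = [ v ⁅1⁆ , 0ℤ , v E , 0ℤ ]
  c (suc zero) = [ v ⁅2⁆ , 0ℤ , 0ℤ , 0ℤ ]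
  sum : v ≗[ suc j ] (λ U → wedgeSum e₁ (c zero) U + (wedgeSum e₂ (c (suc zero)) U + 0ℤ))
  sum ∅ ()
  sum ⁅1⁆ _ = sym (begin
    wedgeSum e₁ (c zero) ⁅1⁆ + (wedgeSum e₂ (c (suc zero)) ⁅1⁆ + 0ℤ)
      ≡⟨ cong₂ (λ p q → p + (q + 0ℤ)) (wedgeSum-⁅1⁆ e₁ (c zero)) (wedgeSum-⁅1⁆ e₂ (c (suc zero))) ⟩
    v ⁅1⁆ * 1ℤ + (v ⁅2⁆ * 0ℤ + 0ℤ)
      ≡⟨ collapse (v ⁅1⁆) (v ⁅2⁆) ⟩
    v ⁅1⁆ ∎)
    where
    collapse : ∀ p q → p * 1ℤ + (q * 0ℤ + 0ℤ) ≡ p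
    collapse = solve-∀
  sum ⁅2⁆ _ = sym (begin
    wedgeSum e₁ (c zero) ⁅2⁆ + (wedgeSum e₂ (c (suc zero)) ⁅2⁆ + 0ℤ)
      ≡⟨ cong₂ (λ p q → p + (q + 0ℤ)) (wedgeSum-⁅2⁆ e₁ (c zero)) (wedgeSum-⁅2⁆ e₂ (c (suc zero))) ⟩
    v ⁅1⁆ * 0ℤ + (v ⁅2⁆ * 1ℤ + 0ℤ)
      ≡⟨ collapse (v ⁅1⁆) (v ⁅2⁆) ⟩
    v ⁅2⁆ ∎)
    where
    collapse : ∀ p q → p * 0ℤ + (q * 1ℤ + 0ℤ) ≡ q
    collapse = solve-∀
  sum E _ = sym (begin
    wedgeSum e₁ (c zero) E + (wedgeSum e₂ (c (suc zero)) E + 0ℤ)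
      ≡⟨ cong₂ (λ p q → p + (q + 0ℤ)) (wedgeSum-E e₁ (c zero)) (wedgeSum-E e₂ (c (suc zero))) ⟩
    (v E * 1ℤ - 0ℤ * 0ℤ) + ((0ℤ * 0ℤ - 0ℤ * 1ℤ) + 0ℤ)
      ≡⟨ collapse (v E) ⟩
    v E ∎)
    where
    collapse : ∀ p → (p * 1ℤ - 0ℤ * 0ℤ) + ((0ℤ * 0ℤ - 0ℤ * 1ℤ) + 0ℤ) ≡ p
    collapse = solve-∀

module _ {v : Λ 2} where

  inIdeal⟨a,0⟩¹⇔ : ∀ a → InIdeal (v2 a 0ℤ ∷ []) 1 v ⇔ (a ∣ v ⁅1⁆ × v ⁅2⁆ ≡ 0ℤ)
  inIdeal⟨a,0⟩¹⇔ a = mk⇔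
    (λ h → let (c , v≗) = Equivalence.to (inIdeal-single⇔ l) h in
      divides (c ∅) (trans (v≗ ⁅1⁆ refl) (wedgeSum-⁅1⁆ l c)) ,
      trans (v≗ ⁅2⁆ refl) (trans (wedgeSum-⁅2⁆ l c) (*-zeroʳ (c ∅))))
    (λ (divides k v₁≡ , v₂≡0) → Equivalence.from (inIdeal-single⇔ l) ((λ _ → k) ,
      size≡1-elim (trans v₁≡ (sym (wedgeSum-⁅1⁆ l (λ _ → k))))
                  (trans v₂≡0 (sym (trans (wedgeSum-⁅2⁆ l (λ _ → k)) (*-zeroʳ k))))))
    where l = v2 a 0ℤ

  inIdeal⟨0,b⟩¹⇔ : ∀ b → InIdeal (v2 0ℤ b ∷ []) 1 v ⇔ (v ⁅1⁆ ≡ 0ℤ × b ∣ v ⁅2⁆)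
  inIdeal⟨0,b⟩¹⇔ b = mk⇔
    (λ h → let (c , v≗) = Equivalence.to (inIdeal-single⇔ l) h in
      trans (v≗ ⁅1⁆ refl) (trans (wedgeSum-⁅1⁆ l c) (*-zeroʳ (c ∅))) ,
      divides (c ∅) (trans (v≗ ⁅2⁆ refl) (wedgeSum-⁅2⁆ l c)))
    (λ (v₁≡0 , divides k v₂≡) → Equivalence.from (inIdeal-single⇔ l) ((λ _ → k) ,
      size≡1-elim (trans v₁≡0 (sym (trans (wedgeSum-⁅1⁆ l (λ _ → k)) (*-zeroʳ k))))
                  (trans v₂≡ (sym (wedgeSum-⁅2⁆ l (λ _ → k))))))
    where l = v2 0ℤ b

  inIdeal⟨a,0⟩²⇔ : ∀ a → InIdeal (v2 a 0ℤ ∷ []) 2 v ⇔ a ∣ v E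
  inIdeal⟨a,0⟩²⇔ a = mk⇔
    (λ h → let (c , v≗) = Equivalence.to (inIdeal-single⇔ l) h in
      divides (c ⁅2⁆) (trans (v≗ E refl) (trans (wedgeSum-E l c) (drop (c ⁅2⁆) (c ⁅1⁆) a))))
    (λ (divides k vE≡) → Equivalence.from (inIdeal-single⇔ l) ((λ _ → k) ,
      size≡2-elim (trans vE≡ (sym (trans (wedgeSum-E l (λ _ → k)) (drop k k a))))))
    where
    l = v2 a 0ℤ
    drop : ∀ p q a → p * a - q * 0ℤ ≡ p * a
    drop = solve-∀

  inIdeal⟨0,b⟩²⇔ : ∀ b → InIdeal (v2 0ℤ b ∷ []) 2 v ⇔ b ∣ v E
  inIdeal⟨0,b⟩²⇔ b = mk⇔
    (λ h → let (c , v≗) = Equivalence.to (inIdeal-single⇔ l) h in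
      divides (- c ⁅1⁆) (trans (v≗ E refl) (trans (wedgeSum-E l c) (drop (c ⁅2⁆) (c ⁅1⁆) b))))
    (λ (divides k vE≡) → Equivalence.from (inIdeal-single⇔ l) ((λ _ → - k) ,
      size≡2-elim (trans vE≡ (sym (trans (wedgeSum-E l (λ _ → - k)) (negate k b))))))
    where
    l = v2 0ℤ b
    drop : ∀ p q b → p * 0ℤ - q * b ≡ (- q) * b
    drop = solve-∀
    negate : ∀ k b → (- k) * 0ℤ - (- k) * b ≡ k * b
    negate = solve-∀

module _ (a b : ℤ) where

  cocycle¹-ρab : ∀ {j} x → IsCocycle (ρab a b) 1 (suc j) x
  cocycle¹-ρab x = Equivalence.from (cocycle¹⇔ (ρab a b) x) inIdeal-ℤ²

  cocycle⁰²⇔ : ∀ x → IsCocycle (ρab a b) 0 2 x ⇔ lcm a b ∣ x ∅ E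
  cocycle⁰²⇔ x = mk⇔
    (λ cx → let h₁ , h₂ = Equivalence.to (cocycle⁰⇔ (ρab a b) x) cx in
      ∣ᵤ⇒∣ (lcm-least {a} {b} {x ∅ E} (∣⇒∣ᵤ (Equivalence.to (inIdeal⟨a,0⟩²⇔ a) h₁))
                                       (∣⇒∣ᵤ (Equivalence.to (inIdeal⟨0,b⟩²⇔ b) h₂))))
    (λ lcm∣ → Equivalence.from (cocycle⁰⇔ (ρab a b) x)
      ( Equivalence.from (inIdeal⟨a,0⟩²⇔ a) (∣-trans (∣ᵤ⇒∣ {a} {lcm a b} (i∣lcm[i,j] a b)) lcm∣)
      , Equivalence.from (inIdeal⟨0,b⟩²⇔ b) (∣-trans (∣ᵤ⇒∣ {b} {lcm a b} (j∣lcm[i,j] a b)) lcm∣)))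

  H¹¹≅ℤ/a⊕ℤ/b : HIso (ρab a b) 1 1 (λ x y → x ≈⊕[ a , b ] y) _+⊕_
  H¹¹≅ℤ/a⊕ℤ/b = record
    { to           = residues
    ; from         = representative
    ; to-cong      = λ x y _ _ → residues-cong x y
    ; to-hom       = λ x y _ _ → ≡⇒≡[mod] a (δ-+ x y ⁅1⁆) , ≡⇒≡[mod] b (δ-+ x y ⁅2⁆)
    ; from-cocycle = λ u → cocycle¹-ρab (representative u)
    ; from-cong    = representative-cong
    ; from-to      = λ x _ → δ-section (ρab a b) x (size≡1-elim refl refl)
    ; to-from      = λ (p , q) → ≡⇒≡[mod] a (+-identityʳ p) , ≡⇒≡[mod] b (+-identityʳ q)
    }
    where
    residues : Cochain 2 2 → ℤ × ℤ
    residues x = δ x ⁅1⁆ , δ x ⁅2⁆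

    representative : ℤ × ℤ → Cochain 2 2
    representative (p , q) = [ 0Λ , 0Λ , [ 0ℤ , p , q , 0ℤ ] , 0Λ ]

    residues-cong : ∀ x y → Cohomologous (ρab a b) 1 1 x y → residues x ≈⊕[ a , b ] residues y
    residues-cong x y x~y =
      let s , t , hs , ht , δ≗ = Equivalence.to (cohomologous¹⇔ (ρab a b) x y) x~y
          a∣s₁ , s₂≡0 = Equivalence.to (inIdeal⟨a,0⟩¹⇔ a) hs
          t₁≡0 , b∣t₂ = Equivalence.to (inIdeal⟨0,b⟩¹⇔ b) ht
      in ≡[mod]-by-difference (δ x ⁅1⁆) (δ y ⁅1⁆) (δ≗ ⁅1⁆ refl) (divides 0ℤ t₁≡0) a∣s₁
       , ≡[mod]-by-difference (δ x ⁅2⁆) (δ y ⁅2⁆) (δ≗ ⁅2⁆ refl) b∣t₂ (divides 0ℤ s₂≡0)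

    representative-cong : ∀ u u′ → u ≈⊕[ a , b ] u′ →
                          Cohomologous (ρab a b) 1 1 (representative u) (representative u′)
    representative-cong (p , q) (p′ , q′) (a∣p-p′ , b∣q-q′) =
      Equivalence.from (cohomologous¹⇔ (ρab a b) (representative (p , q)) (representative (p′ , q′)))
        ( [ 0ℤ , - (p - p′) , 0ℤ , 0ℤ ] , [ 0ℤ , 0ℤ , q - q′ , 0ℤ ]
        , Equivalence.from (inIdeal⟨a,0⟩¹⇔ a) (∣m⇒∣-m (∣ᵤ⇒∣ a∣p-p′) , refl)
        , Equivalence.from (inIdeal⟨0,b⟩¹⇔ b) (refl , ∣ᵤ⇒∣ b∣q-q′)
        , size≡1-elim (difference₁ p p′) (difference₂ q q′))
      where
      difference₁ : ∀ p p′ → (p - 0ℤ) - (p′ - 0ℤ) ≡ 0ℤ - - (p - p′)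
      difference₁ = solve-∀
      difference₂ : ∀ q q′ → (q - 0ℤ) - (q′ - 0ℤ) ≡ (q - q′) - 0ℤ
      difference₂ = solve-∀

  H¹²≅ℤ/gcd : HIso (ρab a b) 1 2 (λ x y → x ≡ y [mod gcd a b ]) _+_
  H¹²≅ℤ/gcd = record
    { to           = λ x → δ x E
    ; from         = representative
    ; to-cong      = λ x y _ _ → residue-cong x y
    ; to-hom       = λ x y _ _ → ≡⇒≡[mod] (gcd a b) (δ-+ x y E)
    ; from-cocycle = λ n → cocycle¹-ρab (representative n)
    ; from-cong    = representative-cong
    ; from-to      = λ x _ → δ-section (ρab a b) x (size≡2-elim refl)
    ; to-from      = λ n → ≡⇒≡[mod] (gcd a b) (+-identityʳ n)
    }
    where
    representative : ℤ → Cochain 2 2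
    representative n = [ 0Λ , 0Λ , [ 0ℤ , 0ℤ , 0ℤ , n ] , 0Λ ]

    residue-cong : ∀ x y → Cohomologous (ρab a b) 1 2 x y → δ x E ≡ δ y E [mod gcd a b ]
    residue-cong x y x~y =
      let s , t , hs , ht , δ≗ = Equivalence.to (cohomologous¹⇔ (ρab a b) x y) x~y in
      ≡[mod]-by-difference (δ x E) (δ y E) (δ≗ E refl)
        (∣-trans (∣ᵤ⇒∣ {gcd a b} {b} (gcd[i,j]∣j a b)) (Equivalence.to (inIdeal⟨0,b⟩²⇔ b) ht))
        (∣-trans (∣ᵤ⇒∣ {gcd a b} {a} (gcd[i,j]∣i a b)) (Equivalence.to (inIdeal⟨a,0⟩²⇔ a) hs))

    representative-cong : ∀ n n′ → n ≡ n′ [mod gcd a b ] →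
                          Cohomologous (ρab a b) 1 2 (representative n) (representative n′)
    representative-cong n n′ gcd∣n-n′ =
      let u , v , n-n′≡ = gcd∣⇒lincomb a b (∣ᵤ⇒∣ {gcd a b} {n - n′} gcd∣n-n′) in
      Equivalence.from (cohomologous¹⇔ (ρab a b) (representative n) (representative n′))
        ( [ 0ℤ , 0ℤ , 0ℤ , - (u * a) ] , [ 0ℤ , 0ℤ , 0ℤ , v * b ]
        , Equivalence.from (inIdeal⟨a,0⟩²⇔ a) (divides (- u) (neg-distribˡ-* u a))
        , Equivalence.from (inIdeal⟨0,b⟩²⇔ b) (divides v refl)
        , size≡2-elim (begin
            (n - 0ℤ) - (n′ - 0ℤ)  ≡⟨ cong₂ _-_ (+-identityʳ n) (+-identityʳ n′) ⟩
            n - n′                ≡⟨ n-n′≡ ⟩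
            u * a + v * b         ≡⟨ swap (u * a) (v * b) ⟩
            v * b - - (u * a)     ∎))
      where
      swap : ∀ p q → p + q ≡ q - - p
      swap = solve-∀

  module _ (a≢0 : a ≢ 0ℤ) (b≢0 : b ≢ 0ℤ) where

    private instance
      lcm-nonZero : NonZero (lcm a b)
      lcm-nonZero = ≢-nonZero (lcm≢0 a≢0 b≢0)

    H⁰²≅ℤ : HIso (ρab a b) 0 2 _≡_ _+_
    H⁰²≅ℤ = record
      { to           = quotient
      ; from         = representative
      ; to-cong      = λ x y _ _ → quotient-cong x y
      ; to-hom       = λ x y cx cy → +-distrib-/-∣ (lcm a b) (lcm∣ x cx) (lcm∣ y cy)
      ; from-cocycle = λ n → Equivalence.from (cocycle⁰²⇔ (representative n)) (divides n refl)
      ; from-cong    = λ { n .n refl → representative-refl n }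
      ; from-to      = representative-quotient
      ; to-from      = λ n → i*j/j≡i n (lcm a b)
      }
      where
      quotient : Cochain 2 2 → ℤ
      quotient x = x ∅ E / lcm a b

      representative : ℤ → Cochain 2 2
      representative n = [ [ 0ℤ , 0ℤ , 0ℤ , n * lcm a b ] , 0Λ , 0Λ , 0Λ ]

      lcm∣ : ∀ x → IsCocycle (ρab a b) 0 2 x → lcm a b ∣ x ∅ E
      lcm∣ x = Equivalence.to (cocycle⁰²⇔ x)

      quotient-cong : ∀ x y → Cohomologous (ρab a b) 0 2 x y → quotient x ≡ quotient y
      quotient-cong x y x~y = cong (_/ lcm a b) (i-j≡0⇒i≡j (x ∅ E) (y ∅ E) (x∅-y∅≗0 E refl))
        where
        x∅-y∅≗0 : (λ U → x ∅ U - y ∅ U) ≗[ 2 ] 0Λ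
        x∅-y∅≗0 = inIdeal[]⇒≗0 (Equivalence.to (cohomologous⁰⇔ (ρab a b) x y) x~y)

      representative-refl : ∀ n → Cohomologous (ρab a b) 0 2 (representative n) (representative n)
      representative-refl n =
        Equivalence.from (cohomologous⁰⇔ (ρab a b) (representative n) (representative n))
        (inIdeal-0 [] (λ U _ → +-inverseʳ (representative n ∅ U)))

      representative-quotient : ∀ x → IsCocycle (ρab a b) 0 2 x →
                                Cohomologous (ρab a b) 0 2 (representative (quotient x)) x
      representative-quotient x cx =
        Equivalence.from (cohomologous⁰⇔ (ρab a b) (representative (quotient x)) x)
        (inIdeal-0 [] (size≡2-elim (i≡j⇒i-j≡0 (i/j*j≡i (lcm a b) (lcm∣ x cx)))))

  H⁰⁰-vanishes : Vanishes (ρab a b) 0 0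
  H⁰⁰-vanishes x cx = Equivalence.from (cohomologous⁰⇔ (ρab a b) x 0C)
    (inIdeal-0 [] (size≡0-elim (trans (+-identityʳ _) x∅∅≡0)))
    where
    x∅∅≡0 : x ∅ ∅ ≡ 0ℤ
    x∅∅≡0 = Equivalence.to (inIdeal-deg0⇔ (ρab a b ⁅1⁆))
                           (proj₁ (Equivalence.to (cocycle⁰⇔ (ρab a b) x) cx))

  H⁰¹-vanishes : Vanishes (ρab a b) 0 1
  H⁰¹-vanishes x cx = Equivalence.from (cohomologous⁰⇔ (ρab a b) x 0C)
    (inIdeal-0 [] (size≡1-elim (trans (+-identityʳ _) x∅₁≡0) (trans (+-identityʳ _) x∅₂≡0)))
    where
    x∅∈I₁∩I₂ : InIdeal (ρab a b ⁅1⁆) 1 (x ∅) × InIdeal (ρab a b ⁅2⁆) 1 (x ∅)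
    x∅∈I₁∩I₂ = Equivalence.to (cocycle⁰⇔ (ρab a b) x) cx
    x∅₁≡0 : x ∅ ⁅1⁆ ≡ 0ℤ
    x∅₁≡0 = proj₁ (Equivalence.to (inIdeal⟨0,b⟩¹⇔ b) (proj₂ x∅∈I₁∩I₂))
    x∅₂≡0 : x ∅ ⁅2⁆ ≡ 0ℤ
    x∅₂≡0 = proj₂ (Equivalence.to (inIdeal⟨a,0⟩¹⇔ a) (proj₁ x∅∈I₁∩I₂))

  H¹⁰-vanishes : Vanishes (ρab a b) 1 0
  H¹⁰-vanishes x cx = Equivalence.from (cohomologous¹⇔ (ρab a b) x 0C)
    (0Λ , 0Λ , inIdeal-0 (ρab a b ⁅1⁆) (λ _ _ → refl) , inIdeal-0 (ρab a b ⁅2⁆) (λ _ _ → refl) ,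
     size≡0-elim (trans (+-identityʳ _) δx∅≡0))
    where
    δx∅≡0 : δ x ∅ ≡ 0ℤ
    δx∅≡0 = Equivalence.to (inIdeal-deg0⇔ (ρab a b E))
                           (Equivalence.to (cocycle¹⇔ (ρab a b) x) cx)

  H²⁰-vanishes : Vanishes (ρab a b) 2 0
  H²⁰-vanishes x _ = cohomologous²⇐ (ρab a b) x 0C [ 0Λ , 0Λ , x E , 0Λ ]
    (Equivalence.from (inIdeal-deg0⇔ (ρab a b E)) (+-inverseʳ (x E ∅ - 0ℤ)))

  Hⁱ³⁺-vanishes : ∀ {i j} → Vanishes (ρab a b) i (3 ℕ.+ j)
  Hⁱ³⁺-vanishes = zero-cochains⇒vanishes (ρab a b) (λ S _ _ → inIdeal-deg≥3 (ρab a b S))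

  vanishes : (i j : ℕ) → ¬ (i , j) ≡ (1 , 1) → ¬ (i , j) ≡ (0 , 2) → ¬ (i , j) ≡ (1 , 2) →
             Vanishes (ρab a b) i j
  vanishes 0 0 _ _ _ = H⁰⁰-vanishes
  vanishes 0 1 _ _ _ = H⁰¹-vanishes
  vanishes 0 2 _ ≢02 _ = contradiction refl ≢02
  vanishes 0 (suc (suc (suc _))) _ _ _ = Hⁱ³⁺-vanishes
  vanishes 1 0 _ _ _ = H¹⁰-vanishes
  vanishes 1 1 ≢11 _ _ = contradiction refl ≢11
  vanishes 1 2 _ _ ≢12 = contradiction refl ≢12
  vanishes 1 (suc (suc (suc _))) _ _ _ = Hⁱ³⁺-vanishes
  vanishes 2 0 _ _ _ = H²⁰-vanishes
  vanishes 2 (suc _) _ _ _ = zero-cochains⇒vanishes (ρab a b) (size≡2-elim (λ _ → inIdeal-ℤ²))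
  vanishes (suc (suc (suc _))) _ _ _ _ = zero-cochains⇒vanishes (ρab a b) size≥3-elim

proposition5p5 : (a b : ℤ) → ¬ a ≡ 0ℤ → ¬ b ≡ 0ℤ →
    HIso (ρab a b) 1 1 (λ x y → x ≈⊕[ a , b ] y) _+⊕_
    × HIso (ρab a b) 0 2 _≡_ _+_
    × HIso (ρab a b) 1 2 (λ x y → x ≡ y [mod gcd a b ]) _+_
    × ((i j : ℕ) → ¬ (i , j) ≡ (1 , 1) → ¬ (i , j) ≡ (0 , 2) → ¬ (i , j) ≡ (1 , 2) →
       Vanishes (ρab a b) i j)
proposition5p5 a b a≢0 b≢0 = H¹¹≅ℤ/a⊕ℤ/b a b , H⁰²≅ℤ a b a≢0 b≢0 , H¹²≅ℤ/gcd a b , vanishes a b
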